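{- Let $G$ be a finite simple graph that satisfies Vizing's conjecture. Then for every integer $k \geq 1$, $\gamma(G)^k \leq \gamma(G^k)$.
   Context: A set $S$ of vertices is dominating if every vertex not in $S$ is adjacent to some vertex of $S$; $\gamma(G)$ is the minimum size of a dominating set. The Cartesian product $G \times H$ of graphs $G=(V,E)$ and $H=(W,F)$ has vertex set $V \times W$, with $(v_1,w_1)$ adjacent to $(v_2,w_2)$ iff either $v_1=v_2$ and $w_1w_2 \in F$, or $w_1=w_2$ and $v_1v_2\in E$. $G^k$ denotes the Cartesian product of $k$ copies of $G$. A graph $G$ satisfies Vizing's conjecture if $\gamma(G)\gamma(H) \leq \gamma(G \times H)$ for all finite simple graphs $H$. -}

module Defs where

open import Data.Bool using (Bool; true; false; _∧_; _∨_)
open import Data.Nat using (ℕ; zero; suc; _≤_)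
open import Data.Product using (Σ; _×_; _,_; proj₁; proj₂)
open import Data.Sum using (_⊎_)
open import Data.Unit using (⊤; tt)
open import Data.List using (List; []; _∷_; length; cartesianProduct)
open import Data.List.Membership.Propositional using (_∈_)
open import Data.List.Membership.Propositional.Properties using (∈-cartesianProduct⁺)
open import Data.List.Relation.Unary.Any using (here)
open import Data.List.Relation.Unary.Unique.Propositional using (Unique)
open import Relation.Binary.PropositionalEquality using (_≡_; refl)
open import Relation.Binary.Definitions using (DecidableEquality)
open import Relation.Nullary using (¬_; does)
open import Relation.Nullary.Decidable using (⌊_⌋)
open import Data.Product.Properties using (≡-dec)

record Graph : Set₁ where
  field
    V        : Set
    _≟_      : DecidableEquality V
    verts    : List V
    complete : ∀ v → v ∈ verts
    adj      : V → V → Bool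
    adj-sym  : ∀ u v → adj u v ≡ adj v u
    irrefl   : ∀ v → adj v v ≡ false

open Graph public

IsDominating : (G : Graph) → List (V G) → Set
IsDominating G S = ∀ v → ¬ (v ∈ S) → Σ (V G) λ u → u ∈ S × adj G u v ≡ true

IsDomNum : Graph → ℕ → Set
IsDomNum G d =
  Σ (List (V G)) (λ S → Unique S × IsDominating G S × length S ≡ d)
  × (∀ S → Unique S → IsDominating G S → d ≤ length S)

_□_ : Graph → Graph → Graph
G □ H = record
  { V        = V G × V H
  ; _≟_      = ≡-dec (_≟_ G) (_≟_ H)
  ; verts    = cartesianProduct (verts G) (verts H)
  ; complete = λ p → ∈-cartesianProduct⁺ (complete G (proj₁ p)) (complete H (proj₂ p))
  ; adj      = λ p q → (⌊ _≟_ G (proj₁ p) (proj₁ q) ⌋ ∧ adj H (proj₂ p) (proj₂ q))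
                     ∨ (⌊ _≟_ H (proj₂ p) (proj₂ q) ⌋ ∧ adj G (proj₁ p) (proj₁ q))
  ; adj-sym  = sym'
  ; irrefl   = irr
  }
  where
  open import Relation.Binary.PropositionalEquality using (cong₂; sym)
  open import Relation.Nullary using (yes; no)
  open import Data.Bool.Properties using (∧-zeroʳ)
  eqsym : ∀ {A : Set} (d : DecidableEquality A) x y → ⌊ d x y ⌋ ≡ ⌊ d y x ⌋
  eqsym d x y with d x y | d y x
  ... | yes _ | yes _ = refl
  ... | no _  | no _  = refl
  ... | yes p | no q  = Data.Empty.⊥-elim (q (sym p)) where import Data.Empty
  ... | no p  | yes q = Data.Empty.⊥-elim (p (sym q)) where import Data.Empty
  sym' : ∀ p q → _ ≡ _
  sym' (a , b) (c , d) =
    cong₂ _∨_ (cong₂ _∧_ (eqsym (_≟_ G) a c) (adj-sym H b d))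
              (cong₂ _∧_ (eqsym (_≟_ H) b d) (adj-sym G a c))
  irr : ∀ p → _ ≡ false
  irr (a , b) rewrite irrefl H b | irrefl G a
                    | ∧-zeroʳ ⌊ _≟_ G a a ⌋ | ∧-zeroʳ ⌊ _≟_ H b b ⌋ = refl

K₁ : Graph
K₁ = record
  { V = ⊤ ; _≟_ = λ { tt tt → Relation.Nullary.yes refl } ; verts = tt ∷ []
  ; complete = λ { tt → here refl } ; adj = λ _ _ → false
  ; adj-sym = λ _ _ → refl ; irrefl = λ _ → refl }
  where import Relation.Nullary

_^□_ : Graph → ℕ → Graph
G ^□ zero          = K₁
G ^□ suc zero      = G
G ^□ suc (suc k)   = G □ (G ^□ suc k)

SatisfiesVizing : Graph → Set₁
SatisfiesVizing G = ∀ (H : Graph) (a b c : ℕ) →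
  IsDomNum G a → IsDomNum H b → IsDomNum (G □ H) c → a Data.Nat.* b ≤ c
  where import Data.Nat

-- Every finite graph has a domination number: a minimum-length dominating
-- set can be found among the duplicate-free sublists of its vertex list.
-- Then G^(k+1) = G × G^k, so applying Vizing's inequality to H = G^k
-- gives γ(G) · γ(G^k) ≤ γ(G^(k+1)), and induction on k yields
-- γ(G)^k ≤ γ(G^k).
module Submission where

open import Defs
open import Data.Nat using (ℕ; zero; suc; _≤_; _^_; z≤n; s≤s)
open import Data.Nat.Properties using (≤-reflexive; ≤-trans; ≤-antisym; *-identityʳ; *-monoʳ-≤)
open import Data.Bool.Properties using () renaming (_≟_ to _≟ᵇ_)
open import Data.Bool using (true; false)
open import Data.Product using (_×_; _,_; proj₁)
open import Data.Sum using (_⊎_; inj₁; inj₂)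
open import Data.Empty using (⊥-elim)
open import Data.List using (List; []; _∷_; length; map; _++_; filter; deduplicate)
open import Data.List.Properties using (length-++-sucʳ)
open import Data.List.Extrema.Nat using (argmin; argmin-all; f[argmin]≤f[xs])
open import Data.List.Membership.Propositional using (_∈_; find; lose)
open import Data.List.Membership.Propositional.Properties
  using (∈-map⁺; ∈-++⁺ˡ; ∈-++⁺ʳ; ∈-++⁻; ∈-∃++; ∈-filter⁺; ∈-filter⁻; ∈-deduplicate⁺)
import Data.List.Membership.DecPropositional as DecMembership
open import Data.List.Relation.Binary.Subset.Propositional using (_⊆_)
open import Data.List.Relation.Unary.Any using (Any; here; there; any?)
open import Data.List.Relation.Unary.All as All using (All; all?)
open import Data.List.Relation.Unary.All.Properties using (all-filter; All¬⇒¬Any)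
open import Data.List.Relation.Unary.Unique.Propositional using (Unique; _∷_)
import Data.List.Relation.Unary.Unique.Propositional.Properties as Unique
import Data.List.Relation.Unary.Unique.DecPropositional as DecUnique
import Data.List.Relation.Unary.Unique.DecPropositional.Properties as DecUniqueₚ
open import Relation.Binary.PropositionalEquality using (_≡_; refl; sym; trans; subst)
open import Relation.Nullary using (¬_; Dec; yes; no; does)
open import Relation.Nullary.Decidable using (map′; _×-dec_; _⊎-dec_)

subsequences : {A : Set} → List A → List (List A)
subsequences []       = [] ∷ []
subsequences (x ∷ xs) = map (x ∷_) (subsequences xs) ++ subsequences xs

filter∈subsequences : {A : Set} {P : A → Set} (P? : ∀ x → Dec (P x)) (xs : List A) →
  filter P? xs ∈ subsequences xs
filter∈subsequences P? []       = here refl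
filter∈subsequences P? (x ∷ xs) with does (P? x)
... | true  = ∈-++⁺ˡ (∈-map⁺ (x ∷_) (filter∈subsequences P? xs))
... | false = ∈-++⁺ʳ (map (x ∷_) (subsequences xs)) (filter∈subsequences P? xs)

∈-++-∷⁻ : {A : Set} {x z : A} (ys zs : List A) → z ∈ ys ++ x ∷ zs → ¬ z ≡ x → z ∈ ys ++ zs
∈-++-∷⁻ ys zs z∈ z≢x with ∈-++⁻ ys z∈
... | inj₁ z∈ys         = ∈-++⁺ˡ z∈ys
... | inj₂ (here z≡x)   = ⊥-elim (z≢x z≡x)
... | inj₂ (there z∈zs) = ∈-++⁺ʳ ys z∈zs

unique-⊆⇒length≤ : {A : Set} {xs ys : List A} → Unique xs → xs ⊆ ys → length xs ≤ length ys
unique-⊆⇒length≤ {xs = []}     _            _    = z≤n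
unique-⊆⇒length≤ {xs = x ∷ xs} (x∉xs ∷ !xs) x∷xs⊆ys with ∈-∃++ (x∷xs⊆ys (here refl))
... | ys₁ , ys₂ , refl = subst (suc (length xs) ≤_) (sym (length-++-sucʳ ys₁ x ys₂))
  (s≤s (unique-⊆⇒length≤ !xs λ z∈xs →
    ∈-++-∷⁻ ys₁ ys₂ (x∷xs⊆ys (there z∈xs)) λ { refl → All¬⇒¬Any x∉xs z∈xs }))

IsDomNum-unique : ∀ {G a b} → IsDomNum G a → IsDomNum G b → a ≡ b
IsDomNum-unique ((Sa , !Sa , domSa , refl) , minA) ((Sb , !Sb , domSb , refl) , minB) =
  ≤-antisym (minA Sb !Sb domSb) (minB Sa !Sa domSa)

module _ (G : Graph) where
  open DecMembership (_≟_ G) using (_∈?_)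

  IsDominating? : ∀ S → Dec (IsDominating G S)
  IsDominating? S = map′ fromAll toAll (all? covered? (verts G))
    where
    Covered : V G → Set
    Covered v = v ∈ S ⊎ Any (λ u → adj G u v ≡ true) S

    covered? : ∀ v → Dec (Covered v)
    covered? v = (v ∈? S) ⊎-dec any? (λ u → adj G u v ≟ᵇ true) S

    fromAll : All Covered (verts G) → IsDominating G S
    fromAll covered v v∉S with All.lookup covered (complete G v)
    ... | inj₁ v∈S        = ⊥-elim (v∉S v∈S)
    ... | inj₂ adjacentTo = find adjacentTo

    toAll : IsDominating G S → All Covered (verts G)
    toAll dom = All.tabulate λ {v} _ → cover v
      where
      cover : ∀ v → Covered v
      cover v with v ∈? S
      ... | yes v∈S = inj₁ v∈S
      ... | no v∉S  = let (u , u∈S , uv) = dom v v∉S in inj₂ (lose u∈S uv)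

  IsUniqueDominating : List (V G) → Set
  IsUniqueDominating S = Unique S × IsDominating G S

  IsUniqueDominating? : ∀ S → Dec (IsUniqueDominating S)
  IsUniqueDominating? S = DecUnique.unique? (_≟_ G) S ×-dec IsDominating? S

  vertices : List (V G)
  vertices = deduplicate (_≟_ G) (verts G)

  ∈-vertices : ∀ v → v ∈ vertices
  ∈-vertices v = ∈-deduplicate⁺ (_≟_ G) (complete G v)

  vertices-isUniqueDominating : IsUniqueDominating vertices
  vertices-isUniqueDominating =
    DecUniqueₚ.deduplicate-! (_≟_ G) (verts G) , λ v v∉ → ⊥-elim (v∉ (∈-vertices v))

  -- A duplicate-free copy of S occurring among the `subsequences vertices`.
  normalise : List (V G) → List (V G)
  normalise S = filter (_∈? S) vertices

  normalise-⊆ : ∀ S → normalise S ⊆ S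
  normalise-⊆ S v∈ with ∈-filter⁻ (_∈? S) {xs = vertices} v∈
  ... | _ , v∈S = v∈S

  normalise-isUniqueDominating : ∀ S → IsDominating G S → IsUniqueDominating (normalise S)
  normalise-isUniqueDominating S dom = Unique.filter⁺ (_∈? S) (proj₁ vertices-isUniqueDominating) , dom′
    where
    dom′ : IsDominating G (normalise S)
    dom′ v v∉ with v ∈? S
    ... | yes v∈S = ⊥-elim (v∉ (∈-filter⁺ (_∈? S) (∈-vertices v) v∈S))
    ... | no v∉S  = let (u , u∈S , uv) = dom v v∉S in
                    u , ∈-filter⁺ (_∈? S) (∈-vertices u) u∈S , uv

  candidates : List (List (V G))
  candidates = filter IsUniqueDominating? (subsequences vertices)

  minimumDominating : List (V G)
  minimumDominating = argmin length vertices candidates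

  γ : ℕ
  γ = length minimumDominating

  minimumDominating-isUniqueDominating : IsUniqueDominating minimumDominating
  minimumDominating-isUniqueDominating = argmin-all length vertices-isUniqueDominating
    (all-filter IsUniqueDominating? (subsequences vertices))

  minimumDominating-minimal : ∀ S → IsDominating G S → γ ≤ length S
  minimumDominating-minimal S dom = ≤-trans
    (All.lookup (f[argmin]≤f[xs] {f = length} vertices candidates)
      (∈-filter⁺ IsUniqueDominating? (filter∈subsequences (_∈? S) vertices) normalS))
    (unique-⊆⇒length≤ (proj₁ normalS) (normalise-⊆ S))
    where
    normalS : IsUniqueDominating (normalise S)
    normalS = normalise-isUniqueDominating S dom

  γ-isDomNum : IsDomNum G γ
  γ-isDomNum with unique , dominating ← minimumDominating-isUniqueDominating =
    (minimumDominating , unique , dominating , refl) , λ S _ → minimumDominating-minimal S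

lemma8 : (G : Graph) → SatisfiesVizing G →
    ∀ (k : ℕ) → 1 ≤ k → ∀ (a b : ℕ) →
    IsDomNum G a → IsDomNum (G ^□ k) b → a ^ k ≤ b
lemma8 G vizing (suc k) _ a b γG≡a γGᵏ≡b =
  subst (a ^ suc k ≤_) (IsDomNum-unique {G ^□ suc k} (γ-isDomNum (G ^□ suc k)) γGᵏ≡b) (power≤γ k)
  where
  power≤γ : ∀ n → a ^ suc n ≤ γ (G ^□ suc n)
  power≤γ zero    = ≤-reflexive (trans (*-identityʳ a) (IsDomNum-unique {G} γG≡a (γ-isDomNum G)))
  power≤γ (suc n) = ≤-trans (*-monoʳ-≤ a (power≤γ n))
    (vizing (G ^□ suc n) a _ _ γG≡a (γ-isDomNum (G ^□ suc n)) (γ-isDomNum (G ^□ suc (suc n))))
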